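{- Let $L$ be an IL-algebra and $F$ a distributive filter of $L$. Then the quotient lattice $L/F$ is distributive.
   Context: An IL-algebra is a structure $(L,\cup,\cap,\bot,\to,\ast,1)$ such that $(L,\cup,\cap)$ is a lattice (with order $\leq$) having least element $\bot$; $(L,\ast,1)$ is a commutative monoid with unit $1$; and for all $x,y,z\in L$, $x\ast y\leq z$ if and only if $x\leq y\to z$ (residuation). A filter of $L$ is a non-empty subset $F\subseteq L$ such that: $1\in F$; if $x,y\in F$ then $x\ast y\in F$ and $x\cap y\in F$; if $x\in F$ and $x\leq y$ then $y\in F$. A filter $F$ is distributive if $((x\cup y)\cap(x\cup z))\to(x\cup(y\cap z))\in F$ for all $x,y,z\in L$. For a filter $F$, the relation $x\,\rho\, y$ iff ($x\to y\in F$ and $y\to x\in F$) is a congruence; $[x]$ denotes the class of $x$, $L/F=\{[x]:x\in L\}$, with lattice operations $[x]\cup[y]=[x\cup y]$, $[x]\cap[y]=[x\cap y]$. -}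

module Defs where

open import Level using (Level; suc; _⊔_)
open import Relation.Binary.PropositionalEquality using (_≡_)
open import Data.Product using (_×_)

record ILAlgebra (a : Level) : Set (suc a) where
  infixr 6 _∪_
  infixr 7 _∩_
  infixr 5 _⇒_
  infixl 8 _∗_
  field
    Carrier : Set a
    _∪_ _∩_ _⇒_ _∗_ : Carrier → Carrier → Carrier
    ⊥ 𝟙 : Carrier
    ∪-comm   : ∀ x y → x ∪ y ≡ y ∪ x
    ∩-comm   : ∀ x y → x ∩ y ≡ y ∩ x
    ∪-assoc  : ∀ x y z → (x ∪ y) ∪ z ≡ x ∪ (y ∪ z)
    ∩-assoc  : ∀ x y z → (x ∩ y) ∩ z ≡ x ∩ (y ∩ z)
    ∪-absorbs-∩ : ∀ x y → x ∪ (x ∩ y) ≡ x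
    ∩-absorbs-∪ : ∀ x y → x ∩ (x ∪ y) ≡ x

  infix 4 _≤_
  _≤_ : Carrier → Carrier → Set a
  x ≤ y = x ∩ y ≡ x

  field
    ⊥-least : ∀ x → ⊥ ≤ x
    ∗-assoc    : ∀ x y z → (x ∗ y) ∗ z ≡ x ∗ (y ∗ z)
    ∗-comm     : ∀ x y → x ∗ y ≡ y ∗ x
    ∗-identity : ∀ x → 𝟙 ∗ x ≡ x
    residuation₁ : ∀ x y z → x ∗ y ≤ z → x ≤ y ⇒ z
    residuation₂ : ∀ x y z → x ≤ y ⇒ z → x ∗ y ≤ z

module _ {a : Level} (L : ILAlgebra a) where
  open ILAlgebra L

  -- A filter, given as a predicate on the carrier (non-emptiness follows from 𝟙 ∈ F).
  record IsFilter {ℓ : Level} (F : Carrier → Set ℓ) : Set (a ⊔ ℓ) where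
    field
      𝟙∈F   : F 𝟙
      ∗-closed : ∀ {x y} → F x → F y → F (x ∗ y)
      ∩-closed : ∀ {x y} → F x → F y → F (x ∩ y)
      up-closed : ∀ {x y} → F x → x ≤ y → F y

  IsDistributiveFilter : {ℓ : Level} (F : Carrier → Set ℓ) → Set (a ⊔ ℓ)
  IsDistributiveFilter F =
    IsFilter F × (∀ x y z → F (((x ∪ y) ∩ (x ∪ z)) ⇒ (x ∪ (y ∩ z))))

  -- The congruence ρ_F: [x] = [y] in L/F iff x ρ y.
  _≈[_]_ : {ℓ : Level} → Carrier → (Carrier → Set ℓ) → Carrier → Set ℓ
  x ≈[ F ] y = F (x ⇒ y) × F (y ⇒ x)

  -- L/F is a distributive lattice: with [x] ∪ [y] = [x ∪ y], [x] ∩ [y] = [x ∩ y],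
  -- both distributive laws hold for classes.
  QuotientDistributive : {ℓ : Level} (F : Carrier → Set ℓ) → Set (a ⊔ ℓ)
  QuotientDistributive F =
    (∀ x y z → (x ∩ (y ∪ z)) ≈[ F ] ((x ∩ y) ∪ (x ∩ z)))
    × (∀ x y z → (x ∪ (y ∩ z)) ≈[ F ] ((x ∪ y) ∩ (x ∪ z)))

-- A distributive filter is exactly what reverses x ∪ (y ∩ z) ≤ (x ∪ y) ∩ (x ∪ z) modulo F.
-- By residuation, x ≲ y ⇔ x ⇒ y ∈ F is a preorder containing ≤ and compatible with x ∩ _,
-- so the usual derivation of the law x ∩ (y ∪ z) ≤ (x ∩ y) ∪ (x ∩ z) from the other
-- distributive law goes through with ≲ in place of ≤.
module Submission where

open import Defs
open import Level using (Level)
open import Data.Product using (_,_; proj₁; proj₂)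
open import Relation.Binary.Core using (Rel)
open import Relation.Binary.PropositionalEquality
  using (_≡_; sym; cong; cong₂; subst; subst₂; isEquivalence; module ≡-Reasoning)
open import Algebra.Lattice.Bundles using (Lattice)
import Algebra.Lattice.Properties.Lattice as LatticeProperties
open import Relation.Binary.Lattice.Bundles as Order using ()
import Relation.Binary.Reasoning.Base.Single as SingleReasoning

module LatticeOrder {a : Level} (L : ILAlgebra a) where
  open ILAlgebra L

  ∪-∩-lattice : Lattice a a
  ∪-∩-lattice = record
    { Carrier   = Carrier
    ; _≈_       = _≡_
    ; _∨_       = _∪_
    ; _∧_       = _∩_
    ; isLattice = record
      { isEquivalence = isEquivalence
      ; ∨-comm        = ∪-comm
      ; ∨-assoc       = ∪-assoc
      ; ∨-cong        = cong₂ _∪_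
      ; ∧-comm        = ∩-comm
      ; ∧-assoc       = ∩-assoc
      ; ∧-cong        = cong₂ _∩_
      ; absorptive    = ∪-absorbs-∩ , ∩-absorbs-∪
      }
    }

  -- The library orders a lattice by x ≡ x ∩ y, the symmetric form of _≤_.
  private
    module O = Order.Lattice (LatticeProperties.∨-∧-orderTheoreticLattice ∪-∩-lattice)

  ≤-refl : ∀ {x} → x ≤ x
  ≤-refl = sym O.refl

  ≤-trans : ∀ {x y z} → x ≤ y → y ≤ z → x ≤ z
  ≤-trans p q = sym (O.trans (sym p) (sym q))

  x∩y≤x : ∀ x y → x ∩ y ≤ x
  x∩y≤x x y = sym (O.x∧y≤x x y)

  x∩y≤y : ∀ x y → x ∩ y ≤ y
  x∩y≤y x y = sym (O.x∧y≤y x y)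

  ∩-greatest : ∀ {x y z} → x ≤ y → x ≤ z → x ≤ y ∩ z
  ∩-greatest p q = sym (O.∧-greatest (sym p) (sym q))

  x≤x∪y : ∀ x y → x ≤ x ∪ y
  x≤x∪y x y = sym (O.x≤x∨y x y)

  y≤x∪y : ∀ x y → y ≤ x ∪ y
  y≤x∪y x y = sym (O.y≤x∨y x y)

  ∪-least : ∀ {x y z} → x ≤ z → y ≤ z → x ∪ y ≤ z
  ∪-least p q = sym (O.∨-least (sym p) (sym q))

  ∪-∩-distrib-≤ : ∀ x y z → x ∪ (y ∩ z) ≤ (x ∪ y) ∩ (x ∪ z)
  ∪-∩-distrib-≤ x y z =
    ∪-least (∩-greatest (x≤x∪y x y) (x≤x∪y x z))
            (∩-greatest (≤-trans (x∩y≤x y z) (y≤x∪y x y)) (≤-trans (x∩y≤y y z) (y≤x∪y x z)))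

  ∩-∪-distrib-≥ : ∀ x y z → (x ∩ y) ∪ (x ∩ z) ≤ x ∩ (y ∪ z)
  ∩-∪-distrib-≥ x y z =
    ∪-least (∩-greatest (x∩y≤x x y) (≤-trans (x∩y≤y x y) (x≤x∪y y z)))
            (∩-greatest (x∩y≤x x z) (≤-trans (x∩y≤y x z) (y≤x∪y y z)))

module Residuation {a : Level} (L : ILAlgebra a) where
  open ILAlgebra L
  open LatticeOrder L

  ⇒-eval : ∀ x y → (x ⇒ y) ∗ x ≤ y
  ⇒-eval x y = residuation₂ (x ⇒ y) x y ≤-refl

  ∗-monoˡ-≤ : ∀ {x y} z → x ≤ y → x ∗ z ≤ y ∗ z
  ∗-monoˡ-≤ {y = y} z x≤y = residuation₂ _ z (y ∗ z) (≤-trans x≤y (residuation₁ y z (y ∗ z) ≤-refl))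

  ∗-monoʳ-≤ : ∀ {x y} z → x ≤ y → z ∗ x ≤ z ∗ y
  ∗-monoʳ-≤ {x} {y} z x≤y = subst₂ _≤_ (∗-comm x z) (∗-comm y z) (∗-monoˡ-≤ z x≤y)

  𝟙≤⇒ : ∀ {x y} → x ≤ y → 𝟙 ≤ x ⇒ y
  𝟙≤⇒ {x} {y} x≤y = residuation₁ 𝟙 x y (subst (_≤ y) (sym (∗-identity x)) x≤y)

  ⇒-compose : ∀ x y z → (x ⇒ y) ∗ (y ⇒ z) ≤ x ⇒ z
  ⇒-compose x y z = residuation₁ _ x z (subst (_≤ z) (sym reassociate) chain)
    where
    open ≡-Reasoning
    reassociate : ((x ⇒ y) ∗ (y ⇒ z)) ∗ x ≡ (y ⇒ z) ∗ ((x ⇒ y) ∗ x)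
    reassociate = begin
      ((x ⇒ y) ∗ (y ⇒ z)) ∗ x ≡⟨ cong (_∗ x) (∗-comm (x ⇒ y) (y ⇒ z)) ⟩
      ((y ⇒ z) ∗ (x ⇒ y)) ∗ x ≡⟨ ∗-assoc (y ⇒ z) (x ⇒ y) x ⟩
      (y ⇒ z) ∗ ((x ⇒ y) ∗ x) ∎
    chain : (y ⇒ z) ∗ ((x ⇒ y) ∗ x) ≤ z
    chain = ≤-trans (∗-monoʳ-≤ (y ⇒ z) (⇒-eval x y)) (⇒-eval y z)

  ⇒-∩-monoʳ : ∀ x y z → (y ⇒ z) ∩ 𝟙 ≤ (x ∩ y) ⇒ (x ∩ z)
  ⇒-∩-monoʳ x y z = residuation₁ _ (x ∩ y) (x ∩ z) (∩-greatest below-x below-z)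
    where
    below-x : ((y ⇒ z) ∩ 𝟙) ∗ (x ∩ y) ≤ x
    below-x = ≤-trans (∗-monoˡ-≤ (x ∩ y) (x∩y≤y (y ⇒ z) 𝟙))
                      (subst (_≤ x) (sym (∗-identity (x ∩ y))) (x∩y≤x x y))
    below-z : ((y ⇒ z) ∩ 𝟙) ∗ (x ∩ y) ≤ z
    below-z = ≤-trans (∗-monoˡ-≤ (x ∩ y) (x∩y≤x (y ⇒ z) 𝟙))
                      (≤-trans (∗-monoʳ-≤ (y ⇒ z) (x∩y≤y x y)) (⇒-eval y z))

module FilterPreorder {a ℓ : Level} (L : ILAlgebra a) {F : ILAlgebra.Carrier L → Set ℓ}
                      (isFilter : IsFilter L F) where
  open ILAlgebra L
  open IsFilter isFilter
  open LatticeOrder L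
  open Residuation L

  infix 4 _≲_
  _≲_ : Rel Carrier ℓ
  x ≲ y = F (x ⇒ y)

  infix 4 _ρ_
  _ρ_ : Rel Carrier ℓ
  x ρ y = _≈[_]_ L x F y

  ≤⇒≲ : ∀ {x y} → x ≤ y → x ≲ y
  ≤⇒≲ x≤y = up-closed 𝟙∈F (𝟙≤⇒ x≤y)

  ≲-refl : ∀ {x} → x ≲ x
  ≲-refl = ≤⇒≲ ≤-refl

  ≲-trans : ∀ {x y z} → x ≲ y → y ≲ z → x ≲ z
  ≲-trans {x} {y} {z} p q = up-closed (∗-closed p q) (⇒-compose x y z)

  ∩-monoʳ-≲ : ∀ x {y z} → y ≲ z → x ∩ y ≲ x ∩ z
  ∩-monoʳ-≲ x {y} {z} p = up-closed (∩-closed p 𝟙∈F) (⇒-∩-monoʳ x y z)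

  module ≲-Reasoning = SingleReasoning _≲_ ≲-refl ≲-trans

module DistributiveFilter {a ℓ : Level} (L : ILAlgebra a) {F : ILAlgebra.Carrier L → Set ℓ}
                          (isDistributiveFilter : IsDistributiveFilter L F) where
  open ILAlgebra L
  open LatticeOrder L
  open FilterPreorder L (proj₁ isDistributiveFilter)

  ∪-∩-distrib-≳ : ∀ x y z → (x ∪ y) ∩ (x ∪ z) ≲ x ∪ (y ∩ z)
  ∪-∩-distrib-≳ = proj₂ isDistributiveFilter

  ∪-distribˡ-∩ : ∀ x y z → x ∪ (y ∩ z) ρ (x ∪ y) ∩ (x ∪ z)
  ∪-distribˡ-∩ x y z = ≤⇒≲ (∪-∩-distrib-≤ x y z) , ∪-∩-distrib-≳ x y z

  ∩-∪-distrib-≲ : ∀ x y z → x ∩ (y ∪ z) ≲ (x ∩ y) ∪ (x ∩ z)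
  ∩-∪-distrib-≲ x y z = begin
    x ∩ (y ∪ z)                    ∼⟨ ≤⇒≲ spread ⟩
    x ∩ ((z ∪ x) ∩ (z ∪ y))        ∼⟨ ∩-monoʳ-≲ x (∪-∩-distrib-≳ z x y) ⟩
    x ∩ (z ∪ (x ∩ y))              ∼⟨ ≤⇒≲ regroup ⟩
    ((x ∩ y) ∪ x) ∩ ((x ∩ y) ∪ z)  ∼⟨ ∪-∩-distrib-≳ (x ∩ y) x z ⟩
    (x ∩ y) ∪ (x ∩ z)              ∎
    where
    open ≲-Reasoning
    spread : x ∩ (y ∪ z) ≤ x ∩ ((z ∪ x) ∩ (z ∪ y))
    spread = ∩-greatest (x∩y≤x x (y ∪ z))
      (∩-greatest (≤-trans (x∩y≤x x (y ∪ z)) (y≤x∪y z x))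
                  (≤-trans (x∩y≤y x (y ∪ z)) (∪-least (y≤x∪y z y) (x≤x∪y z y))))
    regroup : x ∩ (z ∪ (x ∩ y)) ≤ ((x ∩ y) ∪ x) ∩ ((x ∩ y) ∪ z)
    regroup = ∩-greatest (≤-trans (x∩y≤x x _) (y≤x∪y (x ∩ y) x))
      (≤-trans (x∩y≤y x _) (∪-least (y≤x∪y (x ∩ y) z) (x≤x∪y (x ∩ y) z)))

  ∩-distribˡ-∪ : ∀ x y z → x ∩ (y ∪ z) ρ (x ∩ y) ∪ (x ∩ z)
  ∩-distribˡ-∪ x y z = ∩-∪-distrib-≲ x y z , ≤⇒≲ (∩-∪-distrib-≥ x y z)

mainTheorem8 : {a ℓ : Level} (L : ILAlgebra a) (F : ILAlgebra.Carrier L → Set ℓ) →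
               IsDistributiveFilter L F → QuotientDistributive L F
mainTheorem8 L F isDistributiveFilter = ∩-distribˡ-∪ , ∪-distribˡ-∩
  where open DistributiveFilter L isDistributiveFilter
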